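{- Let $n$ and $s$ be integers with $n\ge 2s\ge 0$. Then every graph $G\in\mathscr{E}(n,s)$ contains two disjoint independent sets of size $s$.
   Context: $\mathrm{ex}(n,s)$ is the maximum number of edges in a triangle-free graph on $n$ vertices with independence number at most $s$. $\mathscr{E}(n,s)$ is the family of triangle-free graphs $G$ on $n$ vertices with $\alpha(G)\le s$ and exactly $\mathrm{ex}(n,s)$ edges. -}

module Defs where

open import Data.Nat using (ℕ; _≤_; _<_; _+_)
open import Data.Bool using (Bool; true; false; if_then_else_)
open import Data.Fin using (Fin; toℕ; _<?_)
open import Data.Fin.Subset using (Subset; _∈_; _∉_; ∣_∣)
open import Data.List using (List; map; allFin)
open import Data.Nat.ListAction using (sum)
open import Data.Empty using (⊥)
open import Data.Product using (Σ; _×_; _,_; ∃)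
open import Relation.Binary.PropositionalEquality using (_≡_)
open import Relation.Nullary using (¬_)
open import Relation.Nullary.Decidable using (does)

record Graph (n : ℕ) : Set where
  field
    adj     : Fin n → Fin n → Bool
    symm    : ∀ i j → adj i j ≡ adj j i
    irrefl  : ∀ i → adj i i ≡ false
open Graph public

Adj : ∀ {n} → Graph n → Fin n → Fin n → Set
Adj G i j = adj G i j ≡ true

edges : ∀ {n} → Graph n → ℕ
edges {n} G =
  sum (map (λ i → sum (map (λ j → if does (i <? j) then (if adj G i j then 1 else 0) else 0)
                            (allFin n)))
           (allFin n))

TriangleFree : ∀ {n} → Graph n → Set
TriangleFree G = ∀ i j k → Adj G i j → Adj G j k → Adj G i k → ⊥

Independent : ∀ {n} → Graph n → Subset n → Set
Independent G S = ∀ i j → i ∈ S → j ∈ S → ¬ Adj G i j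

IndepNumAtMost : ∀ {n} → Graph n → ℕ → Set
IndepNumAtMost {n} G s = ∀ (S : Subset n) → Independent G S → ∣ S ∣ ≤ s

Admissible : ∀ {n} → ℕ → Graph n → Set
Admissible s G = TriangleFree G × IndepNumAtMost G s

-- G ∈ 𝓔(n,s): admissible and having the maximum number ex(n,s) of edges
-- among all admissible graphs on n vertices.
InExtremal : (n s : ℕ) → Graph n → Set
InExtremal n s G = Admissible s G × (∀ (H : Graph n) → Admissible s H → edges H ≤ edges G)

Disjoint : ∀ {n} → Subset n → Subset n → Set
Disjoint S T = ∀ i → i ∈ S → i ∉ T

module Submission where

-- The argument rests on *switching* a vertex u: its neighbourhood is
-- replaced by a set h ∌ u.  This changes the number of edges by
-- |h| − deg u and keeps the graph triangle-free when h is independent.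
-- If G is extremal and a switch yields a triangle-free graph with more
-- edges, that graph has an independent set S with |S| > s, and deleting
-- the switched vertices from S leaves an independent s-set of G.
--
-- From these we first find one
-- independent s-set and then a second one disjoint from it.

open import Defs
open import Data.Nat using (ℕ; zero; suc; _+_; _*_; _≤_; _<_; z≤n; s≤s; s≤s⁻¹)
open import Data.Nat.Properties
  using ( +-0-commutativeMonoid; +-assoc; +-comm; +-identityʳ; +-suc
        ; +-monoʳ-≤; +-mono-≤-<; +-monoʳ-<; +-mono-<-≤; +-cancelʳ-≤; *-cancelˡ-≡
        ; ≤-refl; ≤-trans; ≤-antisym; ≤-reflexive; <-≤-trans; ≤-<-trans
        ; <⇒≱; ≮⇒≥; ≰⇒>; <-irrefl; module ≤-Reasoning)
import Data.Nat.Properties as ℕ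
open import Data.Nat.Tactic.RingSolver using (solve-∀)
open import Data.Bool using (Bool; true; false; if_then_else_)
open import Data.Bool.Properties using (¬-not) renaming (_≟_ to _≟ᵇ_)
open import Data.Fin using (Fin; zero; suc; _≟_; _<?_; punchIn)
open import Data.Fin.Properties using (<-cmp; punchInᵢ≢i; all?; any?)
open import Data.Fin.Subset using (Subset; _∈_; _∉_; ∣_∣; ⊤; Nonempty)
  renaming (⊥ to ∅)
open import Data.Fin.Subset.Properties
  using ( _∈?_; drop-there; ∉⊥; ∣⊥∣≡0; ∣⊤∣≡n; ∣p∣≤∣x∷p∣; nonempty?
        ; Empty-unique; anySubset?; x∈p⇒∣p-x∣<∣p∣)
open import Data.Vec using ([]; _∷_; lookup; tabulate; _[_]≔_)
open import Data.Vec.Properties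
  using (lookup∘tabulate; lookup∘update; lookup∘update′; []=⇒lookup; lookup⇒[]=)
open import Data.Vec.Functional using (removeAt)
import Data.List as List
import Data.List.Properties as List
open import Data.List.Membership.Propositional.Properties
  using (∈-allFin; ∈-cartesianProduct⁺)
open import Data.List.Relation.Unary.All as All using ()
open import Data.List.Extrema.Nat using (argmax; f[xs]≤f[argmax]; f[⊥]≤f[argmax])
open import Data.Nat.ListAction using () renaming (sum to listSum)
open import Algebra.Properties.CommutativeMonoid.Sum +-0-commutativeMonoid
  using (sum; sum-syntax; sum-cong-≗; ∑-distrib-+; ∑-comm; sum-remove)
open import Data.Product using (Σ; ∃; _×_; _,_; proj₁; proj₂)
open import Data.Sum using (_⊎_; inj₁; inj₂)
import Data.Sum as Sum
open import Data.Empty using (⊥; ⊥-elim)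
open import Function using (_∘_; id)
open import Relation.Binary using (tri<; tri≈; tri>)
open import Relation.Binary.PropositionalEquality
  using (_≡_; _≢_; refl; sym; trans; cong; cong₂; subst; subst₂; _≗_; module ≡-Reasoning)
open import Relation.Nullary using (¬_; Dec; yes; no; does; contradiction)
open import Relation.Nullary.Decidable using (dec-true; dec-false; ¬?; _×-dec_; _→-dec_)

bit : Bool → ℕ
bit b = if b then 1 else 0

bit≤1 : ∀ b → bit b ≤ 1
bit≤1 true  = ≤-refl
bit≤1 false = z≤n

∑-update : ∀ {n} (f g : Fin n → ℕ) (u : Fin n) → (∀ j → j ≢ u → f j ≡ g j) →
           sum f + g u ≡ sum g + f u
∑-update {suc n} f g u agree = begin
  sum f + g u                        ≡⟨ cong (_+ g u) (sum-remove {i = u} f) ⟩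
  f u + sum (removeAt f u) + g u     ≡⟨ cong (λ r → f u + r + g u) (sum-cong-≗ away) ⟩
  f u + sum (removeAt g u) + g u     ≡⟨ swap-ends (f u) _ (g u) ⟩
  g u + sum (removeAt g u) + f u     ≡⟨ cong (_+ f u) (sym (sum-remove {i = u} g)) ⟩
  sum g + f u                        ∎
  where
  open ≡-Reasoning
  away : removeAt f u ≗ removeAt g u
  away j = agree (punchIn u j) (punchInᵢ≢i u j)
  swap-ends : ∀ a r b → a + r + b ≡ b + r + a
  swap-ends = solve-∀

sum-allFin : ∀ {n} (f : Fin n → ℕ) → listSum (List.map f (List.allFin n)) ≡ sum f
sum-allFin f = trans (cong listSum (List.map-tabulate id f)) (sum-tabulate f)
  where
  sum-tabulate : ∀ {n} (f : Fin n → ℕ) → listSum (List.tabulate f) ≡ sum f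
  sum-tabulate {zero}  f = refl
  sum-tabulate {suc n} f = cong (f zero +_) (sum-tabulate (f ∘ suc))

deg : ∀ {n} → Graph n → Fin n → ℕ
deg {n} G x = ∑[ j < n ] bit (adj G x j)

degreeSum : ∀ {n} → Graph n → ℕ
degreeSum {n} G = ∑[ i < n ] deg G i

upper : ∀ {n} → Graph n → Fin n → Fin n → ℕ
upper G i j = if does (i <? j) then bit (adj G i j) else 0

edges-double-sum : ∀ {n} (G : Graph n) → edges G ≡ ∑[ i < n ] ∑[ j < n ] upper G i j
edges-double-sum {n} G = trans (sum-allFin {n} _) (sum-cong-≗ (λ i → sum-allFin (upper G i)))

bit-split : ∀ {n} (G : Graph n) i j → bit (adj G i j) ≡ upper G i j + upper G j i
bit-split G i j with <-cmp i j
... | tri< i<j _ j≮i rewrite dec-true (i <? j) i<j | dec-false (j <? i) j≮i =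
  sym (+-identityʳ _)
... | tri> i≮j _ j<i rewrite dec-false (i <? j) i≮j | dec-true (j <? i) j<i =
  cong bit (symm G i j)
... | tri≈ i≮i refl _ rewrite dec-false (i <? i) i≮i | irrefl G i = refl

handshake : ∀ {n} (G : Graph n) → degreeSum G ≡ edges G + edges G
handshake {n} G = begin
  ∑[ i < n ] ∑[ j < n ] bit (adj G i j)
    ≡⟨ sum-cong-≗ (λ i → sum-cong-≗ (bit-split G i)) ⟩
  ∑[ i < n ] ∑[ j < n ] (upper G i j + upper G j i)
    ≡⟨ sum-cong-≗ (λ i → ∑-distrib-+ (upper G i) (λ j → upper G j i)) ⟩
  ∑[ i < n ] (∑[ j < n ] upper G i j + ∑[ j < n ] upper G j i)
    ≡⟨ ∑-distrib-+ (λ i → ∑[ j < n ] upper G i j) (λ i → ∑[ j < n ] upper G j i) ⟩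
  E + ∑[ i < n ] ∑[ j < n ] upper G j i
    ≡⟨ cong (E +_) (∑-comm (λ i j → upper G j i)) ⟩
  E + E
    ≡⟨ sym (cong₂ _+_ (edges-double-sum G) (edges-double-sum G)) ⟩
  edges G + edges G ∎
  where
  open ≡-Reasoning
  E : ℕ
  E = ∑[ i < n ] ∑[ j < n ] upper G i j

-- Two graphs agreeing away from u: the degree sums differ by twice the
-- difference of the degrees of u (rows and columns of u both change).
degreeSum-change : ∀ {n} (G H : Graph n) (u : Fin n) →
  (∀ i j → i ≢ u → j ≢ u → adj G i j ≡ adj H i j) →
  degreeSum G + (deg H u + deg H u) ≡ degreeSum H + (deg G u + deg G u)
degreeSum-change {n} G H u agree = begin
  degreeSum G + (deg H u + deg H u)     ≡⟨ regroup (degreeSum G) (deg H u) ⟩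
  degreeSum G + deg H u + (deg H u + 0) ≡⟨ cong₂ _+_ (sym (rowSum G H)) (cong (deg H u +_) (sym (loop G))) ⟩
  sum (f G H) + f H G u                 ≡⟨ ∑-update (f G H) (f H G) u row-change ⟩
  sum (f H G) + f G H u                 ≡⟨ cong₂ _+_ (rowSum H G) (cong (deg G u +_) (loop H)) ⟩
  degreeSum H + deg G u + (deg G u + 0) ≡⟨ sym (regroup (degreeSum H) (deg G u)) ⟩
  degreeSum H + (deg G u + deg G u)     ∎
  where
  open ≡-Reasoning
  f : Graph n → Graph n → Fin n → ℕ
  f A B i = deg A i + bit (adj B i u)
  row-change : ∀ i → i ≢ u → f G H i ≡ f H G i
  row-change i i≢u =
    ∑-update _ _ u (λ j j≢u → cong bit (agree i j i≢u j≢u))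
  rowSum : ∀ A B → sum (f A B) ≡ degreeSum A + deg B u
  rowSum A B = trans (∑-distrib-+ (deg A) (λ i → bit (adj B i u)))
                     (cong (degreeSum A +_) (sum-cong-≗ (λ i → cong bit (symm B i u))))
  loop : ∀ A → bit (adj A u u) ≡ 0
  loop A = cong bit (irrefl A u)
  regroup : ∀ a b → a + (b + b) ≡ a + b + (b + 0)
  regroup = solve-∀

edges-change : ∀ {n} (G H : Graph n) (u : Fin n) →
  (∀ i j → i ≢ u → j ≢ u → adj G i j ≡ adj H i j) →
  edges G + deg H u ≡ edges H + deg G u
edges-change G H u agree = *-cancelˡ-≡ _ _ 2 (begin
  2 * (edges G + deg H u)                   ≡⟨ double (edges G) (deg H u) ⟩
  edges G + edges G + (deg H u + deg H u)   ≡⟨ cong (_+ _) (sym (handshake G)) ⟩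
  degreeSum G + (deg H u + deg H u)         ≡⟨ degreeSum-change G H u agree ⟩
  degreeSum H + (deg G u + deg G u)         ≡⟨ cong (_+ _) (handshake H) ⟩
  edges H + edges H + (deg G u + deg G u)   ≡⟨ sym (double (edges H) (deg G u)) ⟩
  2 * (edges H + deg G u)                   ∎)
  where
  open ≡-Reasoning
  double : ∀ a b → 2 * (a + b) ≡ a + a + (b + b)
  double = solve-∀

∈⇒lookup : ∀ {n} {j : Fin n} {p : Subset n} → j ∈ p → lookup p j ≡ true
∈⇒lookup = []=⇒lookup

lookup⇒∈ : ∀ {n} {j : Fin n} {p : Subset n} → lookup p j ≡ true → j ∈ p
lookup⇒∈ = lookup⇒[]= _ _

card-sum : ∀ {n} (p : Subset n) → ∣ p ∣ ≡ ∑[ j < n ] bit (lookup p j)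
card-sum []          = refl
card-sum (true ∷ p)  = cong suc (card-sum p)
card-sum (false ∷ p) = card-sum p

card-update : ∀ {n} (p : Subset n) i b → ∣ p [ i ]≔ b ∣ + bit (lookup p i) ≡ ∣ p ∣ + bit b
card-update (true  ∷ p) zero true  = refl
card-update (true  ∷ p) zero false = trans (+-comm ∣ p ∣ 1) (sym (+-identityʳ _))
card-update (false ∷ p) zero true  = trans (+-identityʳ _) (+-comm 1 ∣ p ∣)
card-update (false ∷ p) zero false = refl
card-update (true  ∷ p) (suc i) b  = cong suc (card-update p i b)
card-update (false ∷ p) (suc i) b  = card-update p i b

delete : ∀ {n} → Subset n → Fin n → Subset n
delete p i = p [ i ]≔ false

delete-card : ∀ {n} (p : Subset n) i → ∣ delete p i ∣ + bit (lookup p i) ≡ ∣ p ∣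
delete-card p i = trans (card-update p i false) (+-identityʳ _)

∈-delete : ∀ {n} {p : Subset n} {i j} → j ∈ delete p i → j ∈ p × j ≢ i
∈-delete {p = p} {i} {j} j∈ with j ≟ i
... | yes refl = contradiction (trans (sym (lookup∘update i p false)) (∈⇒lookup j∈)) λ ()
... | no j≢i  = lookup⇒∈ (trans (sym (lookup∘update′ j≢i p false)) (∈⇒lookup j∈)) , j≢i

cover : ∀ {n} (A B : Subset n) → (∀ j → j ∈ A ⊎ j ∈ B) → n ≤ ∣ A ∣ + ∣ B ∣
cover [] [] _ = z≤n
cover {suc n} (a ∷ A) (b ∷ B) covers = step a b (covers zero)
  where
  rest : n ≤ ∣ A ∣ + ∣ B ∣
  rest = cover A B (Sum.map drop-there drop-there ∘ covers ∘ suc)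
  step : ∀ a b → zero ∈ a ∷ A ⊎ zero ∈ b ∷ B → suc n ≤ ∣ a ∷ A ∣ + ∣ b ∷ B ∣
  step true  b     _        = s≤s (≤-trans rest (+-monoʳ-≤ ∣ A ∣ (∣p∣≤∣x∷p∣ b B)))
  step false true  _        = ≤-trans (s≤s rest) (≤-reflexive (sym (+-suc ∣ A ∣ ∣ B ∣)))
  step false false (inj₁ ())
  step false false (inj₂ ())

outside-both : ∀ {n} (A B : Subset n) → ∣ A ∣ + ∣ B ∣ < n → ∃ λ j → j ∉ A × j ∉ B
outside-both A B small with any? (λ j → ¬? (j ∈? A) ×-dec ¬? (j ∈? B))
... | yes found = found
... | no none   = contradiction (cover A B covers) (<⇒≱ small)
  where
  covers : ∀ j → j ∈ A ⊎ j ∈ B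
  covers j with j ∈? A | j ∈? B
  ... | yes j∈A | _       = inj₁ j∈A
  ... | no  _   | yes j∈B = inj₂ j∈B
  ... | no  j∉A | no  j∉B = ⊥-elim (none (j , j∉A , j∉B))

nonempty : ∀ {n} (p : Subset n) → 0 < ∣ p ∣ → Nonempty p
nonempty {n} p pos with nonempty? p
... | yes ne    = ne
... | no  empty = contradiction (trans (cong ∣_∣ (Empty-unique empty)) (∣⊥∣≡0 n)) (λ e → <-irrefl (sym e) pos)

adj-distinct : ∀ {n} (G : Graph n) {i j} → Adj G i j → i ≢ j
adj-distinct G {i} i~j refl = contradiction (trans (sym i~j) (irrefl G i)) λ ()

Nb : ∀ {n} → Graph n → Fin n → Subset n
Nb G x = tabulate (adj G x)

∈Nb⇒adj : ∀ {n} (G : Graph n) {x j} → j ∈ Nb G x → Adj G x j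
∈Nb⇒adj G {x} {j} j∈ = trans (sym (lookup∘tabulate (adj G x) j)) (∈⇒lookup j∈)

adj⇒∈Nb : ∀ {n} (G : Graph n) {x j} → Adj G x j → j ∈ Nb G x
adj⇒∈Nb G {x} {j} x~j = lookup⇒∈ (trans (lookup∘tabulate (adj G x) j) x~j)

∉Nb⇒nonadj : ∀ {n} (G : Graph n) {x j} → j ∉ Nb G x → adj G x j ≡ false
∉Nb⇒nonadj G j∉ = ¬-not (j∉ ∘ adj⇒∈Nb G)

Nb-sym : ∀ {n} (G : Graph n) {x y} → y ∈ Nb G x → x ∈ Nb G y
Nb-sym G {x} {y} y∈ = adj⇒∈Nb G (trans (symm G y x) (∈Nb⇒adj G y∈))

Nb-card : ∀ {n} (G : Graph n) x → ∣ Nb G x ∣ ≡ deg G x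
Nb-card G x =
  trans (card-sum (Nb G x)) (sum-cong-≗ (λ j → cong bit (lookup∘tabulate (adj G x) j)))

neighbour : ∀ {n} (G : Graph n) x → 0 < deg G x → ∃ λ y → Adj G x y
neighbour G x pos with nonempty (Nb G x) (subst (0 <_) (sym (Nb-card G x)) pos)
... | y , y∈ = y , ∈Nb⇒adj G y∈

Nb-independent : ∀ {n} (G : Graph n) → TriangleFree G → ∀ x → Independent G (Nb G x)
Nb-independent G tf x i j i∈ j∈ i~j = tf x i j (∈Nb⇒adj G i∈) i~j (∈Nb⇒adj G j∈)

deg≤s : ∀ {n s} (G : Graph n) → Admissible s G → ∀ x → deg G x ≤ s
deg≤s G (tf , α≤s) x = subst (_≤ _) (Nb-card G x) (α≤s (Nb G x) (Nb-independent G tf x))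

full-Nb : ∀ {n s} (G : Graph n) → Admissible s G → ∀ z → s ≤ deg G z → ∣ Nb G z ∣ ≡ s
full-Nb G admissible z full = trans (Nb-card G z) (≤-antisym (deg≤s G admissible z) full)

Nb-disjoint : ∀ {n} (G : Graph n) → TriangleFree G → ∀ {x y} → Adj G x y →
              Disjoint (Nb G x) (Nb G y)
Nb-disjoint G tf x~y j jx jy = tf _ _ j x~y (∈Nb⇒adj G jy) (∈Nb⇒adj G jx)

Independent? : ∀ {n} (G : Graph n) S → Dec (Independent G S)
Independent? G S =
  all? λ i → all? λ j → (i ∈? S) →-dec (j ∈? S) →-dec ¬? (adj G i j ≟ᵇ true)

large-independent : ∀ {n s} (H : Graph n) → ¬ IndepNumAtMost H s →
                    ∃ λ S → Independent H S × s < ∣ S ∣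
large-independent {s = s} H unbounded
  with anySubset? (λ S → Independent? H S ×-dec (s ℕ.<? ∣ S ∣))
... | yes found = found
... | no  none  = ⊥-elim (unbounded λ S ind → ≮⇒≥ (λ big → none (S , ind , big)))

beats-extremal : ∀ {n s} (G : Graph n) → InExtremal n s G →
                 (H : Graph n) → TriangleFree H → edges G < edges H →
                 ∃ λ S → Independent H S × s < ∣ S ∣
beats-extremal G (_ , maximal) H tf more =
  large-independent H (λ α≤s → <⇒≱ more (maximal H (tf , α≤s)))

one-end : ∀ {n} (H : Graph n) (S : Subset n) → Independent H S → ∀ {u v} → Adj H u v →
          bit (lookup S v) + bit (lookup S u) ≤ 1
one-end H S indS {u} {v} u~v with lookup S u in u∈S | lookup S v in v∈S
... | true  | true  = contradiction (indS u v (lookup⇒∈ u∈S) (lookup⇒∈ v∈S) u~v) id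
... | true  | false = ≤-refl
... | false | b     = subst (_≤ 1) (sym (+-identityʳ (bit b))) (bit≤1 b)

switchedAdj : ∀ {n} → Graph n → Fin n → Subset n → Fin n → Fin n → Bool
switchedAdj G u h i j =
  if does (i ≟ u) then lookup h j else if does (j ≟ u) then lookup h i else adj G i j

module _ {n} (G : Graph n) (u : Fin n) (h : Subset n) where

  switched-row : ∀ {i} j → i ≡ u → switchedAdj G u h i j ≡ lookup h j
  switched-row j refl rewrite dec-true (u ≟ u) refl = refl

  switched-off : ∀ {i j} → i ≢ u → j ≢ u → switchedAdj G u h i j ≡ adj G i j
  switched-off {i} {j} i≢u j≢u rewrite dec-false (i ≟ u) i≢u | dec-false (j ≟ u) j≢u = refl

  switched-col : lookup h u ≡ false → ∀ i {j} → j ≡ u → switchedAdj G u h i j ≡ lookup h i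
  switched-col u∉h i refl = by-cases (i ≟ u)
    where
    by-cases : Dec (i ≡ u) → switchedAdj G u h i u ≡ lookup h i
    by-cases (yes i≡u) = trans (switched-row u i≡u) (cong (lookup h) (sym i≡u))
    by-cases (no i≢u) rewrite dec-false (i ≟ u) i≢u | dec-true (u ≟ u) refl = refl

switch : ∀ {n} (G : Graph n) (u : Fin n) (h : Subset n) → lookup h u ≡ false → Graph n
switch G u h u∉h = record { adj = switchedAdj G u h ; symm = symmetric ; irrefl = loopless }
  where
  symmetric : ∀ i j → switchedAdj G u h i j ≡ switchedAdj G u h j i
  symmetric i j = by-cases (i ≟ u) (j ≟ u)
    where
    by-cases : Dec (i ≡ u) → Dec (j ≡ u) → switchedAdj G u h i j ≡ switchedAdj G u h j i
    by-cases (yes i≡u) _         = trans (switched-row G u h j i≡u) (sym (switched-col G u h u∉h j i≡u))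
    by-cases (no _)    (yes j≡u) = trans (switched-col G u h u∉h i j≡u) (sym (switched-row G u h i j≡u))
    by-cases (no i≢u)  (no j≢u)  = trans (switched-off G u h i≢u j≢u)
                                     (trans (symm G i j) (sym (switched-off G u h j≢u i≢u)))
  loopless : ∀ i → switchedAdj G u h i i ≡ false
  loopless i with i ≟ u
  ... | yes refl = u∉h
  ... | no  _    = irrefl G i

switch-edges : ∀ {n} (G : Graph n) u h (u∉h : lookup h u ≡ false) →
               edges G + ∣ h ∣ ≡ edges (switch G u h u∉h) + deg G u
switch-edges G u h u∉h = begin
  edges G + ∣ h ∣     ≡⟨ cong (edges G +_) (trans (card-sum h) (sum-cong-≗ row)) ⟩
  edges G + deg H u   ≡⟨ edges-change G H u (λ i j i≢u j≢u → sym (switched-off G u h i≢u j≢u)) ⟩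
  edges H + deg G u   ∎
  where
  open ≡-Reasoning
  H : Graph _
  H = switch G u h u∉h
  row : ∀ j → bit (lookup h j) ≡ bit (adj H u j)
  row j = cong bit (sym (switched-row G u h j refl))

Triangle : ∀ {n} → Graph n → Fin n → Fin n → Fin n → Set
Triangle G i j k = Adj G i j × Adj G j k × Adj G i k

rotate : ∀ {n} (G : Graph n) {i j k} → Triangle G i j k → Triangle G j k i
rotate G {i} {j} {k} (i~j , j~k , i~k) = j~k , trans (symm G k i) i~k , trans (symm G j i) i~j

TriangleFreeOutside : ∀ {n} → Graph n → (Fin n → Set) → Set
TriangleFreeOutside G A = ∀ i j k → ¬ A i → ¬ A j → ¬ A k → ¬ Triangle G i j k

tf⇒outside : ∀ {n} (G : Graph n) → TriangleFree G → ∀ A → TriangleFreeOutside G A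
tf⇒outside G tf A i j k _ _ _ (i~j , j~k , i~k) = tf i j k i~j j~k i~k

outside-nothing⇒tf : ∀ {n} (G : Graph n) → TriangleFreeOutside G (λ _ → ⊥) → TriangleFree G
outside-nothing⇒tf G tf i j k i~j j~k i~k = tf i j k id id id (i~j , j~k , i~k)

switch-triangles : ∀ {n} (G : Graph n) u h (u∉h : lookup h u ≡ false) (A : Fin n → Set) →
  TriangleFreeOutside G (λ i → A i ⊎ i ≡ u) →
  (∀ {j k} → ¬ A j → ¬ A k → lookup h j ≡ true → lookup h k ≡ true → ¬ Adj G j k) →
  TriangleFreeOutside (switch G u h u∉h) A
switch-triangles {n} G u h u∉h A tf indep = avoid
  where
  H : Graph n
  H = switch G u h u∉h
  old : ∀ {a b} → a ≢ u → b ≢ u → Adj H a b → Adj G a b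
  old a≢u b≢u a~b = trans (sym (switched-off G u h a≢u b≢u)) a~b
  -- a triangle through u would join two vertices of h
  through-u : ∀ {a b} → ¬ A a → ¬ A b → ¬ Triangle H u a b
  through-u {a} {b} ¬Aa ¬Ab (u~a , a~b , u~b) =
    indep ¬Aa ¬Ab (trans (sym (switched-row G u h a refl)) u~a)
                  (trans (sym (switched-row G u h b refl)) u~b)
                  (old a≢u b≢u a~b)
    where
    a≢u : a ≢ u
    a≢u = adj-distinct H u~a ∘ sym
    b≢u : b ≢ u
    b≢u = adj-distinct H u~b ∘ sym
  avoid : TriangleFreeOutside H A
  avoid i j k ¬Ai ¬Aj ¬Ak t = by-cases (i ≟ u) (j ≟ u) (k ≟ u)
    where
    by-cases : Dec (i ≡ u) → Dec (j ≡ u) → Dec (k ≡ u) → ⊥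
    by-cases (yes i≡u) _ _ = through-u ¬Aj ¬Ak (subst (λ z → Triangle H z j k) i≡u t)
    by-cases (no _) (yes j≡u) _ =
      through-u ¬Ak ¬Ai (subst (λ z → Triangle H z k i) j≡u (rotate H {i} t))
    by-cases (no _) (no _) (yes k≡u) =
      through-u ¬Ai ¬Aj (subst (λ z → Triangle H z i j) k≡u (rotate H {j} (rotate H {i} t)))
    by-cases (no i≢u) (no j≢u) (no k≢u) =
      tf i j k Sum.[ ¬Ai , i≢u ] Sum.[ ¬Aj , j≢u ] Sum.[ ¬Ak , k≢u ]
         (old i≢u j≢u (proj₁ t) , old j≢u k≢u (proj₁ (proj₂ t)) , old i≢u k≢u (proj₂ (proj₂ t)))

cancel-< : ∀ {x y p q} → x + p ≡ y + q → q < p → x < y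
cancel-< {x} {y} {p} {q} e q<p = ≰⇒> λ y≤x → <-irrefl (sym e) (+-mono-≤-< y≤x q<p)

exactly-s : ∀ {n s} (G : Graph n) {T : Subset n} {k} → IndepNumAtMost G s →
            Independent G T → s < ∣ T ∣ + k → k ≤ 1 → ∣ T ∣ ≡ s
exactly-s {s = s} G {T} {k} α≤s indT big k≤1 =
  ≤-antisym (α≤s T indT) (+-cancelʳ-≤ 1 s ∣ T ∣ (begin
    s + 1      ≡⟨ +-comm s 1 ⟩
    suc s      ≤⟨ big ⟩
    ∣ T ∣ + k  ≤⟨ +-monoʳ-≤ ∣ T ∣ k≤1 ⟩
    ∣ T ∣ + 1  ∎))
  where open ≤-Reasoning

-- Edge bookkeeping of the double switch G → K → H: the first switch trades
-- du edges at u for a, the second trades dv edges at v for b, and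
-- a + b ≥ dx + dy + 1 because a + p = dx + 1, b + q = dy + 1, p + q ≤ 1.
double-switch-gain : ∀ {eG eK eH a b p q du dv dx dy} →
  eG + a ≡ eK + du → eK + b ≡ eH + dv →
  a + p ≡ dx + 1 → b + q ≡ dy + 1 → p + q ≤ 1 →
  du + dv ≤ dx + dy → eG < eH
double-switch-gain {eG} {eK} {eH} {a} {b} {p} {q} {du} {dv} {dx} {dy} e₁ e₂ e₃ e₄ pq≤1 light =
  cancel-< total gain
  where
  total : eG + (a + b) ≡ eH + (du + dv)
  total = begin
    eG + (a + b)  ≡⟨ sym (+-assoc eG a b) ⟩
    eG + a + b    ≡⟨ cong (_+ b) e₁ ⟩
    eK + du + b   ≡⟨ swap eK du b ⟩
    eK + b + du   ≡⟨ cong (_+ du) e₂ ⟩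
    eH + dv + du  ≡⟨ sym (swap' eH du dv) ⟩
    eH + (du + dv) ∎
    where
    open ≡-Reasoning
    swap : ∀ x y z → x + y + z ≡ x + z + y
    swap = solve-∀
    swap' : ∀ x y z → x + (y + z) ≡ x + z + y
    swap' = solve-∀
  gain : du + dv < a + b
  gain = ≤-<-trans light (+-cancelʳ-≤ 1 _ _ (begin
    suc (dx + dy) + 1        ≡⟨ regroup dx dy ⟩
    (dx + 1) + (dy + 1)      ≡⟨ sym (cong₂ _+_ e₃ e₄) ⟩
    (a + p) + (b + q)        ≡⟨ regroup' a p b q ⟩
    (a + b) + (p + q)        ≤⟨ +-monoʳ-≤ (a + b) pq≤1 ⟩
    (a + b) + 1              ∎))
    where
    open ≤-Reasoning
    regroup : ∀ x y → suc (x + y) + 1 ≡ (x + 1) + (y + 1)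
    regroup = solve-∀
    regroup' : ∀ x y z w → (x + y) + (z + w) ≡ (x + z) + (y + w)
    regroup' = solve-∀

-- Switching
-- u to N gains edges, so the switched graph has an independent set S with
-- |S| > s.  Then S − u is an independent s-set of G; in particular S
-- contains u, so S − u avoids N (all of N is adjacent to u after switching).
switching-lemma : ∀ {n s} (G : Graph n) → InExtremal n s G →
  (N : Subset n) → Independent G N → (u : Fin n) → u ∉ N → deg G u < ∣ N ∣ →
  ∃ λ T → Independent G T × ∣ T ∣ ≡ s × Disjoint T N
switching-lemma {n} {s} G ext@((tf , α≤s) , _) N indN u u∉N light = T , indT , sizeT , disjoint
  where
  u∉N′ : lookup N u ≡ false
  u∉N′ = ¬-not (u∉N ∘ lookup⇒∈)
  H : Graph n
  H = switch G u N u∉N′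
  tfH : TriangleFree H
  tfH = outside-nothing⇒tf H (switch-triangles G u N u∉N′ (λ _ → ⊥) (tf⇒outside G tf _)
          (λ {j} {k} _ _ j∈N k∈N → indN j k (lookup⇒∈ j∈N) (lookup⇒∈ k∈N)))
  large : ∃ λ S → Independent H S × s < ∣ S ∣
  large = beats-extremal G ext H tfH (cancel-< (switch-edges G u N u∉N′) light)
  S : Subset n
  S = proj₁ large
  indS : Independent H S
  indS = proj₁ (proj₂ large)
  T : Subset n
  T = delete S u
  indT : Independent G T
  indT i j i∈T j∈T =
    let (i∈S , i≢u) = ∈-delete i∈T
        (j∈S , j≢u) = ∈-delete j∈T
    in indS i j i∈S j∈S ∘ trans (switched-off G u N i≢u j≢u)
  big : s < ∣ T ∣ + bit (lookup S u)
  big = subst (s <_) (sym (delete-card S u)) (proj₂ (proj₂ large))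
  sizeT : ∣ T ∣ ≡ s
  sizeT = exactly-s G α≤s indT big (bit≤1 _)
  u∈S : lookup S u ≡ true
  u∈S = ¬-not λ u∉S → <-irrefl refl (subst (s <_) (without-u u∉S) big)
    where
    without-u : lookup S u ≡ false → ∣ T ∣ + bit (lookup S u) ≡ s
    without-u u∉S = trans (cong (λ b → ∣ T ∣ + bit b) u∉S) (trans (+-identityʳ _) sizeT)
  disjoint : Disjoint T N
  disjoint j j∈T j∈N =
    indS u j (lookup⇒∈ u∈S) (proj₁ (∈-delete j∈T)) (trans (switched-row G u N j refl) (∈⇒lookup j∈N))

-- The double switch.  Let xy and uv be edges of a triangle-free graph G,
-- with u adjacent to neither x nor y.  Switch u to N(x) + v, giving K, and
-- then v to N(y) − v + u, giving H.
module DoubleSwitch {n} (G : Graph n) (tf : TriangleFree G) {x y u v : Fin n}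
  (x~y : Adj G x y) (u~v : Adj G u v) (x≁u : adj G x u ≡ false) (y≁u : adj G y u ≡ false)
  where

  u≢v : u ≢ v
  u≢v = adj-distinct G u~v

  hu : Subset n
  hu = Nb G x [ v ]≔ true

  hu-away : ∀ {j} → j ≢ v → lookup hu j ≡ adj G x j
  hu-away {j} j≢v = trans (lookup∘update′ j≢v (Nb G x) true) (lookup∘tabulate (adj G x) j)

  hu∌u : lookup hu u ≡ false
  hu∌u = trans (hu-away u≢v) x≁u

  K : Graph n
  K = switch G u hu hu∌u

  hv : Subset n
  hv = delete (Nb G y) v [ u ]≔ true

  hv∌v : lookup hv v ≡ false
  hv∌v = trans (lookup∘update′ (u≢v ∘ sym) (delete (Nb G y) v) true) (lookup∘update v (Nb G y) false)

  H : Graph n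
  H = switch K v hv hv∌v

  H-agrees : ∀ {i j} → i ≢ u → i ≢ v → j ≢ u → j ≢ v → adj H i j ≡ adj G i j
  H-agrees i≢u i≢v j≢u j≢v = trans (switched-off K v hv i≢v j≢v) (switched-off G u hu i≢u j≢u)

  u~v-in-H : Adj H u v
  u~v-in-H = trans (switched-col K v hv hv∌v u refl) (lookup∘update u (delete (Nb G y) v) true)

  hv-member : ∀ {j} → lookup hv j ≡ true → j ≡ u ⊎ (j ≢ u × j ≢ v × Adj G y j)
  hv-member {j} j∈ with j ≟ u
  ... | yes j≡u = inj₁ j≡u
  ... | no  j≢u with j ≟ v
  ...   | yes refl = contradiction (trans (sym hv∌v) j∈) λ ()
  ...   | no  j≢v  = inj₂ (j≢u , j≢v , trans (sym (lookup∘tabulate (adj G y) j))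
                                         (trans (sym (lookup∘update′ j≢v (Nb G y) false))
                                           (trans (sym (lookup∘update′ j≢u (delete (Nb G y) v) true)) j∈)))

  -- H is triangle-free: every triangle of K passes through v (N(x) is
  -- independent), and hv is independent in K (N(x) and N(y) are disjoint).
  H-triangle-free : TriangleFree H
  H-triangle-free = outside-nothing⇒tf H (switch-triangles K v hv hv∌v (λ _ → ⊥)
    (λ i j k ¬i ¬j ¬k → K-triangles i j k (¬i ∘ inj₂) (¬j ∘ inj₂) (¬k ∘ inj₂)) hv-independent)
    where
    K-triangles : TriangleFreeOutside K (_≡ v)
    K-triangles = switch-triangles G u hu hu∌u (_≡ v) (tf⇒outside G tf _)
      λ {j} {k} j≢v k≢v j∈ k∈ j~k →
        tf x j k (trans (sym (hu-away j≢v)) j∈) j~k (trans (sym (hu-away k≢v)) k∈)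
    u≁Ny : ∀ {k} → k ≢ v → Adj G y k → ¬ Adj K u k
    u≁Ny {k} k≢v y~k u~k =
      tf x y k x~y y~k (trans (sym (hu-away k≢v)) (trans (sym (switched-row G u hu k refl)) u~k))
    hv-independent : ∀ {j k} → ¬ ⊥ → ¬ ⊥ → lookup hv j ≡ true → lookup hv k ≡ true → ¬ Adj K j k
    hv-independent {j} {k} _ _ j∈ k∈ j~k with hv-member j∈ | hv-member k∈
    ... | inj₁ refl | inj₁ refl = adj-distinct K {u} {u} j~k refl
    ... | inj₁ refl | inj₂ (_ , k≢v , y~k) = u≁Ny k≢v y~k j~k
    ... | inj₂ (_ , j≢v , y~j) | inj₁ refl = u≁Ny j≢v y~j (trans (symm K u j) j~k)
    ... | inj₂ (j≢u , _ , y~j) | inj₂ (k≢u , _ , y~k) =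
      tf y j k y~j (trans (sym (switched-off G u hu j≢u k≢u)) j~k) y~k

  size-hu : ∣ hu ∣ + bit (adj G x v) ≡ deg G x + 1
  size-hu = trans (cong (λ b → ∣ hu ∣ + bit b) (sym (lookup∘tabulate (adj G x) v)))
              (trans (card-update (Nb G x) v true) (cong (_+ 1) (Nb-card G x)))

  size-hv : ∣ hv ∣ + bit (adj G y v) ≡ deg G y + 1
  size-hv = begin
    ∣ hv ∣ + bit (adj G y v)                    ≡⟨ cong (_+ bit (adj G y v)) inserted ⟩
    suc (∣ Ny−v ∣ + bit (adj G y v))            ≡⟨ cong (λ b → suc (∣ Ny−v ∣ + bit b))
                                                      (sym (lookup∘tabulate (adj G y) v)) ⟩
    suc (∣ Ny−v ∣ + bit (lookup (Nb G y) v))    ≡⟨ cong suc (trans (delete-card (Nb G y) v) (Nb-card G y)) ⟩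
    suc (deg G y)                               ≡⟨ +-comm 1 (deg G y) ⟩
    deg G y + 1                                 ∎
    where
    open ≡-Reasoning
    Ny−v : Subset n
    Ny−v = delete (Nb G y) v
    u∉Ny−v : lookup Ny−v u ≡ false
    u∉Ny−v = trans (lookup∘update′ u≢v (Nb G y) false) (trans (lookup∘tabulate (adj G y) u) y≁u)
    inserted : ∣ hv ∣ ≡ suc ∣ Ny−v ∣
    inserted = trans (sym (+-identityʳ _))
                 (trans (cong (λ b → ∣ hv ∣ + bit b) (sym u∉Ny−v))
                   (trans (card-update Ny−v u true) (+-comm _ 1)))

  deg-K-v : deg K v ≡ deg G v
  deg-K-v = sum-cong-≗ (λ j → cong bit (row j (j ≟ u)))
    where
    row : ∀ j → Dec (j ≡ u) → adj K v j ≡ adj G v j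
    row j (yes j≡u) = trans (switched-col G u hu hu∌u v j≡u)
      (trans (lookup∘update v (Nb G x) true)
        (sym (trans (cong (adj G v) j≡u) (trans (symm G v u) u~v))))
    row j (no j≢u) = switched-off G u hu (u≢v ∘ sym) j≢u

  v-shared : bit (adj G x v) + bit (adj G y v) ≤ 1
  v-shared with adj G x v in x~v | adj G y v in y~v
  ... | true  | true  = contradiction (tf x y v x~y y~v x~v) id
  ... | true  | false = ≤-refl
  ... | false | b     = bit≤1 b

  H-more-edges : deg G u + deg G v ≤ deg G x + deg G y → edges G < edges H
  H-more-edges = double-switch-gain (switch-edges G u hu hu∌u)
                   (trans (switch-edges K v hv hv∌v) (cong (edges H +_) deg-K-v))
                   size-hu size-hv v-shared

-- If moreover deg u + deg v ≤ deg x + deg y and G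
-- is extremal, the switched graph H beats G, so it has an independent set
-- S with |S| > s.  S contains at most one of the adjacent vertices u, v,
-- and S − u − v is an independent s-set of G.
double-switching-lemma : ∀ {n s} (G : Graph n) → InExtremal n s G → ∀ {x y u v} →
  Adj G x y → Adj G u v → adj G x u ≡ false → adj G y u ≡ false →
  deg G u + deg G v ≤ deg G x + deg G y →
  ∃ λ T → Independent G T × ∣ T ∣ ≡ s
double-switching-lemma {n} {s} G ext@((tf , α≤s) , _) {x} {y} {u} {v} x~y u~v x≁u y≁u light =
  T , indT , exactly-s G α≤s indT (subst (s <_) removed (proj₂ (proj₂ large))) (one-end H S indS u~v-in-H)
  where
  open DoubleSwitch G tf x~y u~v x≁u y≁u
  large : ∃ λ S → Independent H S × s < ∣ S ∣
  large = beats-extremal G ext H H-triangle-free (H-more-edges light)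
  S : Subset n
  S = proj₁ large
  indS : Independent H S
  indS = proj₁ (proj₂ large)
  T : Subset n
  T = delete (delete S u) v
  indT : Independent G T
  indT i j i∈T j∈T =
    let (i∈S−u , i≢v) = ∈-delete i∈T
        (j∈S−u , j≢v) = ∈-delete j∈T
        (i∈S , i≢u)   = ∈-delete i∈S−u
        (j∈S , j≢u)   = ∈-delete j∈S−u
    in indS i j i∈S j∈S ∘ trans (H-agrees i≢u i≢v j≢u j≢v)
  removed : ∣ S ∣ ≡ ∣ T ∣ + (bit (lookup S v) + bit (lookup S u))
  removed = begin
    ∣ S ∣                                            ≡⟨ sym (delete-card S u) ⟩
    ∣ delete S u ∣ + bit (lookup S u)                ≡⟨ cong (_+ bit (lookup S u)) (sym (delete-card (delete S u) v)) ⟩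
    ∣ T ∣ + bit (lookup (delete S u) v) + bit (lookup S u)
                                                     ≡⟨ cong (λ b → ∣ T ∣ + bit b + bit (lookup S u))
                                                          (lookup∘update′ (u≢v ∘ sym) S false) ⟩
    ∣ T ∣ + bit (lookup S v) + bit (lookup S u)      ≡⟨ +-assoc ∣ T ∣ _ _ ⟩
    ∣ T ∣ + (bit (lookup S v) + bit (lookup S u))    ∎
    where open ≡-Reasoning

Heaviest : ∀ {n} → Graph n → Fin n → Fin n → Set
Heaviest G x y = Adj G x y × (∀ {u v} → Adj G u v → deg G u + deg G v ≤ deg G x + deg G y)

heaviest-edge : ∀ {n} (G : Graph n) {a b} → Adj G a b → ∃ λ x → ∃ λ y → Heaviest G x y
heaviest-edge {n} G {a} {b} a~b = proj₁ best , proj₂ best , best-edge , heaviest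
  where
  weight : Fin n × Fin n → ℕ
  weight (i , j) = if adj G i j then suc (deg G i + deg G j) else 0
  pairs : List.List (Fin n × Fin n)
  pairs = List.cartesianProduct (List.allFin n) (List.allFin n)
  best : Fin n × Fin n
  best = argmax weight (a , b) pairs
  maximal : ∀ i j → weight (i , j) ≤ weight best
  maximal i j = All.lookup (f[xs]≤f[argmax] {f = weight} (a , b) pairs)
                           (∈-cartesianProduct⁺ (∈-allFin i) (∈-allFin j))
  edge-weight : ∀ {i j} → Adj G i j → weight (i , j) ≡ suc (deg G i + deg G j)
  edge-weight {i} {j} i~j = cong (λ c → if c then suc (deg G i + deg G j) else 0) i~j
  positive⇒edge : ∀ i j → 0 < weight (i , j) → Adj G i j
  positive⇒edge i j pos with adj G i j
  ... | true  = refl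
  ... | false = contradiction pos λ ()
  best-edge : Adj G (proj₁ best) (proj₂ best)
  best-edge = positive⇒edge (proj₁ best) (proj₂ best)
    (≤-trans (s≤s z≤n) (≤-trans (≤-reflexive (sym (edge-weight a~b))) (f[⊥]≤f[argmax] {f = weight} (a , b) pairs)))
  heaviest : ∀ {u v} → Adj G u v → deg G u + deg G v ≤ deg G (proj₁ best) + deg G (proj₂ best)
  heaviest {u} {v} u~v = s≤s⁻¹ (subst₂ _≤_ (edge-weight u~v) (edge-weight best-edge) (maximal u v))

edge-or-independent : ∀ {n} (G : Graph n) → (∃ λ a → ∃ λ b → Adj G a b) ⊎ Independent G ⊤
edge-or-independent G with any? (λ a → any? (λ b → adj G a b ≟ᵇ true))
... | yes edge = inj₁ edge
... | no none  = inj₂ (λ i j _ _ i~j → none (i , j , i~j))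

degree-positive : ∀ {n} (G : Graph n) {x y} → Adj G x y → 0 < deg G x
degree-positive G {x} x~y =
  subst (0 <_) (Nb-card G x) (≤-<-trans z≤n (x∈p⇒∣p-x∣<∣p∣ (adj⇒∈Nb G x~y)))

-- Along a heaviest edge xy: if deg x = s, N(x) is an independent s-set.
-- Otherwise |N(x)| + |N(y)| < 2s ≤ n, so some u is adjacent to neither x
-- nor y.  If deg u < deg x, switch u to N(x); otherwise u has a neighbour
-- v with deg u + deg v ≤ deg x + deg y, and the double switch applies.
s-set-from-heaviest-edge : ∀ {n s} (G : Graph n) → InExtremal n s G → s + s ≤ n →
  ∀ {x y} → Heaviest G x y → ∃ λ N → Independent G N × ∣ N ∣ ≡ s
s-set-from-heaviest-edge {n} {s} G ext@(admissible@(tf , _) , _) room {x} {y} (x~y , heaviest) =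
  by-cases (s ℕ.≤? deg G x)
  where
  away-from : ∀ u → u ∉ Nb G x → u ∉ Nb G y → ∃ λ N → Independent G N × ∣ N ∣ ≡ s
  away-from u u∉Nx u∉Ny with deg G u ℕ.<? deg G x
  ... | yes lighter =
    let (T , indT , sizeT , _) = switching-lemma G ext (Nb G x) (Nb-independent G tf x) u u∉Nx
                                   (subst (deg G u <_) (sym (Nb-card G x)) lighter)
    in T , indT , sizeT
  ... | no heavier =
    let (v , u~v) = neighbour G u (<-≤-trans (degree-positive G x~y) (≮⇒≥ heavier))
    in double-switching-lemma G ext x~y u~v (∉Nb⇒nonadj G u∉Nx) (∉Nb⇒nonadj G u∉Ny) (heaviest u~v)
  by-cases : Dec (s ≤ deg G x) → ∃ λ N → Independent G N × ∣ N ∣ ≡ s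
  by-cases (yes full) = Nb G x , Nb-independent G tf x , full-Nb G admissible x full
  by-cases (no notFull) =
    let (u , u∉Nx , u∉Ny) = outside-both (Nb G x) (Nb G y) (begin-strict
          ∣ Nb G x ∣ + ∣ Nb G y ∣  ≡⟨ cong₂ _+_ (Nb-card G x) (Nb-card G y) ⟩
          deg G x + deg G y        <⟨ +-mono-<-≤ (≰⇒> notFull) (deg≤s G admissible y) ⟩
          s + s                    ≤⟨ room ⟩
          n                        ∎)
    in away-from u u∉Nx u∉Ny
    where open ≤-Reasoning

-- An extremal graph with n ≥ 2s ≥ 2 has an independent s-set: it has an
-- edge (else all n > s vertices are independent), hence a heaviest one.
independent-s-set : ∀ {n s} (G : Graph n) → InExtremal n s G → 0 < s → s + s ≤ n →
  ∃ λ N → Independent G N × ∣ N ∣ ≡ s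
independent-s-set {n} {s} G ext@((_ , α≤s) , _) s>0 room with edge-or-independent G
... | inj₁ (a , b , a~b) =
  let (x , y , heaviest) = heaviest-edge G a~b in s-set-from-heaviest-edge G ext room heaviest
... | inj₂ all-independent =
  contradiction (subst (_≤ s) (∣⊤∣≡n n) (α≤s ⊤ all-independent))
                (<⇒≱ (<-≤-trans (ℕ.m<m+n s s>0) room))

DisjointPair : ∀ {n} → Graph n → ℕ → Set
DisjointPair {n} G s = Σ (Subset n) λ S → Σ (Subset n) λ T →
  Independent G S × Independent G T × ∣ S ∣ ≡ s × ∣ T ∣ ≡ s × Disjoint S T

-- Given an independent s-set N.  If no degree is below s, the
-- neighbourhoods of the ends of an edge are two disjoint s-sets.  Else
-- some y has deg y < s, and some x lies outside N ∪ N(y).  If deg x < s,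
-- switch x to N; if deg x = s, switch y to N(x).
disjoint-s-sets : ∀ {n s} (G : Graph n) → InExtremal n s G → 0 < s → s + s ≤ n →
  (N : Subset n) → Independent G N → ∣ N ∣ ≡ s → DisjointPair G s
disjoint-s-sets {n} {s} G ext@(admissible@(tf , _) , _) s>0 room N indN sizeN =
  by-cases (any? (λ y → deg G y ℕ.<? s))
  where
  with-low-vertex : ∀ y → deg G y < s → ∀ x → x ∉ N → x ∉ Nb G y → DisjointPair G s
  with-low-vertex y low x x∉N x∉Ny with deg G x ℕ.<? s
  ... | yes xLow =
    let (T , indT , sizeT , T∩N) = switching-lemma G ext N indN x x∉N (subst (deg G x <_) (sym sizeN) xLow)
    in T , N , indT , indN , sizeT , sizeN , T∩N
  ... | no xFull =
    let sizeNx = full-Nb G admissible x (≮⇒≥ xFull)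
        (T , indT , sizeT , T∩Nx) = switching-lemma G ext (Nb G x) (Nb-independent G tf x) y
                                      (x∉Ny ∘ Nb-sym G) (subst (deg G y <_) (sym sizeNx) low)
    in T , Nb G x , indT , Nb-independent G tf x , sizeT , sizeNx , T∩Nx
  by-cases : Dec (∃ λ y → deg G y < s) → DisjointPair G s
  by-cases (yes (y , low)) =
    let (x , x∉N , x∉Ny) = outside-both N (Nb G y) (begin-strict
          ∣ N ∣ + ∣ Nb G y ∣  ≡⟨ cong₂ _+_ sizeN (Nb-card G y) ⟩
          s + deg G y        <⟨ +-monoʳ-< s low ⟩
          s + s              ≤⟨ room ⟩
          n                  ∎)
    in with-low-vertex y low x x∉N x∉Ny
    where open ≤-Reasoning
  by-cases (no regular) =
    let (z , _)   = nonempty N (subst (0 <_) (sym sizeN) s>0)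
        (w , z~w) = neighbour G z (<-≤-trans s>0 (high z))
    in Nb G z , Nb G w , Nb-independent G tf z , Nb-independent G tf w ,
       full-Nb G admissible z (high z) , full-Nb G admissible w (high w) , Nb-disjoint G tf z~w
    where
    high : ∀ z → s ≤ deg G z
    high z = ≮⇒≥ (λ low → regular (z , low))

lemma2p8 : (n s : ℕ) → 2 * s ≤ n → (G : Graph n) → InExtremal n s G →
    Σ (Subset n) (λ S → Σ (Subset n) (λ T →
      Independent G S × Independent G T × ∣ S ∣ ≡ s × ∣ T ∣ ≡ s × Disjoint S T))
lemma2p8 n zero _ G _ =
  ∅ , ∅ , empty-independent , empty-independent , ∣⊥∣≡0 n , ∣⊥∣≡0 n , λ _ i∈∅ _ → ∉⊥ i∈∅
  where
  empty-independent : Independent G ∅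
  empty-independent _ _ i∈∅ _ _ = ∉⊥ i∈∅
lemma2p8 n s@(suc _) 2s≤n G ext =
  let (N , indN , sizeN) = independent-s-set G ext (s≤s z≤n) room
  in disjoint-s-sets G ext (s≤s z≤n) room N indN sizeN
  where
  room : s + s ≤ n
  room = subst (_≤ n) (cong (s +_) (+-identityʳ s)) 2s≤n
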